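{- Let $(\Sigma, I, \to, \preceq)$ be a well-structured transition system and $P \subseteq \Sigma$ a downward-closed set. Suppose $\mathbf{R} \mid Q$ is a state of the rule system described in the context, with $\mathbf{R} = (R_0, \ldots, R_N)$ and $R_0 = \downarrow I$, satisfying (I1) $I \subseteq R_i$ for all $0 \le i \le N$; (I2) $\mathrm{post}(R_i) \subseteq R_{i+1}$ for all $0 \le i < N$; (I3) $R_i \subseteq R_{i+1}$ for all $0 \le i < N$; (I4) $R_i \subseteq P$ for all $0 \le i < N$. If $\mathbf{R} \mid Q \mapsto \mathbf{R}' \mid Q'$ by an application of one of the rules Unfold, Induction, Conflict, CandidateNondet, or DecideNondet, then $\mathbf{R}' \mid Q'$ (with $N$ replaced by the length of $\mathbf{R}'$) also satisfies (I1)–(I4).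
   Context: A well-structured transition system (WSTS) $(\Sigma, I, \to, \preceq)$ consists of a set $\Sigma$ of states, a finite set $I \subseteq \Sigma$ of initial states, a relation $\to \subseteq \Sigma \times \Sigma$, and a well-quasi-order $\preceq$ on $\Sigma$ such that whenever $s_1 \to s_2$ and $s_1 \preceq t_1$, there is $t_2$ with $t_1 \to^{*} t_2$ and $s_2 \preceq t_2$. For $Y \subseteq \Sigma$, $\uparrow Y = \{x \mid \exists y \in Y,\ y \preceq x\}$ and $\downarrow Y = \{x \mid \exists y \in Y,\ x \preceq y\}$; $\uparrow x = \uparrow\{x\}$. For $X \subseteq \Sigma$, $\mathrm{pre}(X) = \{y \mid \exists x \in X,\ y \to x\}$ and $\mathrm{post}(X) = \{y \mid \exists x \in X,\ x \to y\}$. The rule system (generic version). Its states are $\mathsf{Init}$, $\mathsf{valid}$, $\mathsf{invalid}$, and pairs $\mathbf{R} \mid Q$ where $\mathbf{R} = (R_0, \ldots, R_N)$ ($N \ge 0$, called the length) is a vector of downward-closed subsets of $\Sigma$ and $Q$ is a finite priority queue of pairs $\langle a, i\rangle \in \Sigma \times \mathbb{N}$ with priority $i$; $\min Q$ is an element of least priority, $\mathrm{popMin}(Q)$ is $Q$ with that element removed, $\mathrm{push}(Q,x)$ is $Q$ with $x$ added. For $0 \le i \le N$ and $a \in \Sigma$ let $\mathrm{Gen}_i(a) = \{ b \mid b \preceq a,\ \uparrow b \cap I = \emptyset,\ \mathrm{pre}(\uparrow b) \cap (R_i \setminus \uparrow b) = \emptyset\}$. $\mathbf{R}[R_k \gets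 R'_k]_{k=1}^i$ denotes $(R_0, R'_1, \ldots, R'_i, R_{i+1}, \ldots, R_N)$. The relevant rules are: (CandidateNondet) if $a \in R_N \setminus P$: $\mathbf{R} \mid \emptyset \mapsto \mathbf{R} \mid \{\langle a, N\rangle\}$. (DecideNondet) if $\min Q = \langle a, i \rangle$, $i > 0$, $b \in \mathrm{pre}(\uparrow a) \cap (R_{i-1} \setminus \uparrow a)$: $\mathbf{R}\mid Q \mapsto \mathbf{R} \mid \mathrm{push}(Q, \langle b, i-1\rangle)$. (Conflict) if $\min Q = \langle a, i\rangle$, $i>0$, $\mathrm{pre}(\uparrow a) \cap (R_{i-1}\setminus \uparrow a) = \emptyset$ and $b \in \mathrm{Gen}_{i-1}(a)$: $\mathbf{R}\mid Q \mapsto \mathbf{R}[R_k \gets R_k \setminus \uparrow b]_{k=1}^{i} \mid \mathrm{popMin}(Q)$. (Induction) if $R_i = \Sigma \setminus \uparrow\{r_{i,1}, \ldots, r_{i,m}\}$ and $b \in \mathrm{Gen}_i(r_{i,j})$ for some $1 \le j \le m$: $\mathbf{R} \mid \emptyset \mapsto \mathbf{R}[R_k \gets R_k \setminus \uparrow b]_{k=1}^{i+1} \mid \emptyset$. (Unfold) if $R_N \subseteq P$: $\mathbf{R} \mid \emptyset \mapsto (R_0, \ldots, R_N, \Sigma) \mid \emptyset$. In these rules the indices are assumed to lie in the range of the vector. -}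

module Defs where

open import Level using (0ℓ)
open import Data.Nat using (ℕ; zero; suc; _≤_; _<_)
open import Data.Fin using (Fin; zero; suc; toℕ; inject₁)
open import Data.Product using (Σ; ∃; _×_; _,_; proj₂)
open import Data.List using (List; []; _∷_; _++_)
open import Data.List.Relation.Unary.Any using (Any)
open import Data.List.Relation.Unary.All using (All)
import Data.List.Membership.Propositional as LM
open import Relation.Nullary using (¬_)
open import Relation.Binary using (IsPreorder)
open import Relation.Binary.PropositionalEquality using (_≡_)
open import Relation.Binary.Construct.Closure.ReflexiveTransitive using (Star)
open import Relation.Unary using (Pred; _⊆_; _≐_; _∩_; ∁; Empty; U)

record IsWQO {A : Set} (_⪯_ : A → A → Set) : Set where
  field
    isPreorder : IsPreorder _≡_ _⪯_
    good       : (f : ℕ → A) → ∃ λ i → ∃ λ j → i < j × f i ⪯ f j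

record WSTS : Set₁ where
  field
    State  : Set
    Init   : List State
    _⟶_    : State → State → Set
    _⪯_    : State → State → Set
    wqo    : IsWQO _⪯_
    compat : ∀ {s₁ s₂ t₁} → s₁ ⟶ s₂ → s₁ ⪯ t₁ →
             ∃ λ t₂ → Star _⟶_ t₁ t₂ × s₂ ⪯ t₂

module WSTSDefs (W : WSTS) where
  open WSTS W

  Set' : Set₁
  Set' = Pred State 0ℓ

  I : Set'
  I x = x LM.∈ Init

  ↑_ : Set' → Set'
  (↑ Y) x = ∃ λ y → Y y × y ⪯ x

  ↓_ : Set' → Set'
  (↓ Y) x = ∃ λ y → Y y × x ⪯ y

  ↑₁ : State → Set'
  ↑₁ a x = a ⪯ x

  ↑L : List State → Set'
  ↑L rs x = Any (λ r → r ⪯ x) rs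

  pre : Set' → Set'
  pre X y = ∃ λ x → X x × y ⟶ x

  post : Set' → Set'
  post X y = ∃ λ x → X x × x ⟶ y

  DownClosed : Set' → Set
  DownClosed X = ∀ {x y} → y ⪯ x → X x → X y

  _∖_ : Set' → Set' → Set'
  A ∖ B = A ∩ ∁ B

  -- vectors R = (R₀,…,R_N) of subsets, of length N (N+1 entries)
  Frames : ℕ → Set₁
  Frames N = Fin (suc N) → Set'

  -- priority queue of pairs ⟨a , i⟩ with priority i (a finite multiset,
  -- represented as a list; order irrelevant)
  Queue : Set
  Queue = List (Σ State (λ _ → ℕ))

  -- "min Q = ⟨a,i⟩ and popMin Q = Q'": ⟨a,i⟩ occurs in Q, has least
  -- priority, and Q' is Q with that occurrence removed.
  MinPop : Queue → State → ℕ → Queue → Set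
  MinPop Q a i Q' = ∃ λ xs → ∃ λ ys →
    Q ≡ xs ++ ((a , i) ∷ ys) × All (λ p → i ≤ proj₂ p) Q × Q' ≡ xs ++ ys

  push : Queue → State → ℕ → Queue
  push Q a i = (a , i) ∷ Q

  Gen : Set' → State → Set'
  Gen Ri a b = b ⪯ a × Empty (↑₁ b ∩ I) × Empty (pre (↑₁ b) ∩ (Ri ∖ ↑₁ b))

  update : ∀ {N} → Frames N → ℕ → State → Frames N
  update R i b k x = R k x × (1 ≤ toℕ k → toℕ k ≤ i → ¬ (b ⪯ x))

  snoc : ∀ {N} → Frames N → Set' → Frames (suc N)
  snoc {zero}  R S zero          = R zero
  snoc {zero}  R S (suc zero)    = S
  snoc {suc N} R S zero          = R zero
  snoc {suc N} R S (suc k)       = snoc {N} (λ j → R (suc j)) S k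

  last : ∀ {N} → Frames N → Set'
  last {zero}  R = R zero
  last {suc N} R = last {N} (λ j → R (suc j))

  data Step (P : Set') : (N : ℕ) → Frames N → Queue →
                         (N' : ℕ) → Frames N' → Queue → Set₁ where
    candidateNondet : ∀ {N R} (a : State) →
      (last R ∖ P) a →
      Step P N R [] N R ((a , N) ∷ [])
    decideNondet : ∀ {N R Q Q'} (a b : State) (j : Fin N) →
      -- min Q = ⟨a , j+1⟩ (so 0 < j+1 ≤ N)
      MinPop Q a (suc (toℕ j)) Q' →
      (pre (↑₁ a) ∩ (R (inject₁ j) ∖ ↑₁ a)) b →
      Step P N R Q N R (push Q b (toℕ j))
    conflict : ∀ {N R Q Q'} (a b : State) (j : Fin N) →
      MinPop Q a (suc (toℕ j)) Q' →
      Empty (pre (↑₁ a) ∩ (R (inject₁ j) ∖ ↑₁ a)) →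
      Gen (R (inject₁ j)) a b →
      Step P N R Q N (update R (suc (toℕ j)) b) Q'
    induction : ∀ {N R} (i : Fin N) (rs : List State) (r b : State) →
      R (inject₁ i) ≐ (U ∖ ↑L rs) →
      r LM.∈ rs →
      Gen (R (inject₁ i)) r b →
      Step P N R [] N (update R (suc (toℕ i)) b) []
    unfold : ∀ {N R} →
      last R ⊆ P →
      Step P N R [] (suc N) (snoc R U) []

  Invariants : Set' → (N : ℕ) → Frames N → Set
  Invariants P N R =
      (∀ (i : Fin (suc N)) → I ⊆ R i)
    × (∀ (i : Fin N) → post (R (inject₁ i)) ⊆ R (suc i))
    × (∀ (i : Fin N) → R (inject₁ i) ⊆ R (suc i))
    × (∀ (i : Fin N) → R (inject₁ i) ⊆ P)

-- Candidate and Decide leave the frames unchanged, and Unfold appends Σ, which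
-- trivially extends all four invariants. Conflict and Induction remove ↑ b from
-- frames 1 … j+1, where b lies above no initial state and no state of R_j outside
-- ↑ b has a successor in ↑ b. Frames up to j+1 then avoid ↑ b (frame 0 because it
-- is ↓ I), and frames below j+1 are contained in R_j, so a successor of a kept
-- state cannot have been removed: (I2) survives, and (I1), (I3), (I4) are immediate.
module Submission where

open import Defs
open import Data.Nat using (ℕ; zero; suc; _≤_; z≤n; s≤s; s≤s⁻¹)
open import Data.Nat.Properties using (m≤n⇒m≤1+n)
open import Data.Fin using (Fin; zero; suc; toℕ; inject₁)
open import Data.Fin.Properties using (toℕ-inject₁)
open import Data.Product using (_,_; proj₁)
open import Data.Unit using (tt)
open import Relation.Nullary using (¬_)
open import Relation.Unary using (_≐_; _⊆_; _∩_; U; Empty)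
open import Relation.Binary using (IsPreorder)
open import Relation.Binary.PropositionalEquality using (_≡_; refl; sym; subst; subst₂)

module FrameVectors (W : WSTS) where
  open WSTS W
  open WSTSDefs W

  Chain : (Set' → Set' → Set) → ∀ {N} → Frames N → Set
  Chain _∼_ {N} R = ∀ (i : Fin N) → R (inject₁ i) ∼ R (suc i)

  snoc-inject₁ : ∀ {N} (R : Frames N) S (i : Fin (suc N)) → snoc R S (inject₁ i) ≡ R i
  snoc-inject₁ {zero}  R S zero    = refl
  snoc-inject₁ {suc N} R S zero    = refl
  snoc-inject₁ {suc N} R S (suc i) = snoc-inject₁ (λ j → R (suc j)) S i

  snoc-all : (Pr : Set' → Set) → ∀ {N} (R : Frames N) {S} →
             (∀ i → Pr (R i)) → Pr S → ∀ i → Pr (snoc R S i)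
  snoc-all Pr {zero}  R all-R pr-S zero       = all-R zero
  snoc-all Pr {zero}  R all-R pr-S (suc zero) = pr-S
  snoc-all Pr {suc N} R all-R pr-S zero       = all-R zero
  snoc-all Pr {suc N} R all-R pr-S (suc i)    =
    snoc-all Pr (λ j → R (suc j)) (λ j → all-R (suc j)) pr-S i

  snoc-chain : (_∼_ : Set' → Set' → Set) → ∀ {N} (R : Frames N) {S} →
               Chain _∼_ R → last R ∼ S → Chain _∼_ (snoc R S)
  snoc-chain _∼_ {zero}  R chain last∼S zero    = last∼S
  snoc-chain _∼_ {suc N} R {S} chain last∼S zero =
    subst (R zero ∼_) (sym (snoc-inject₁ (λ j → R (suc j)) S zero)) (chain zero)
  snoc-chain _∼_ {suc N} R chain last∼S (suc i) =
    snoc-chain _∼_ (λ j → R (suc j)) (λ j → chain (suc j)) last∼S i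

  init-last-all : (Pr : Set' → Set) → ∀ {N} (R : Frames N) →
                  (∀ (i : Fin N) → Pr (R (inject₁ i))) → Pr (last R) → ∀ i → Pr (R i)
  init-last-all Pr {zero}  R all-init pr-last zero    = pr-last
  init-last-all Pr {suc N} R all-init pr-last zero    = all-init zero
  init-last-all Pr {suc N} R all-init pr-last (suc i) =
    init-last-all Pr (λ j → R (suc j)) (λ j → all-init (suc j)) pr-last i

  chain-mono : ∀ {N} (R : Frames N) → Chain _⊆_ R →
               ∀ (k l : Fin (suc N)) → toℕ k ≤ toℕ l → R k ⊆ R l
  chain-mono {zero}  R chain zero    zero    _         = λ x∈R → x∈R
  chain-mono {suc N} R chain zero    zero    _         = λ x∈R → x∈R
  chain-mono {suc N} R chain zero    (suc l) _         =
    λ x∈R → chain-mono (λ j → R (suc j)) (λ j → chain (suc j)) zero l z≤n (chain zero x∈R)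
  chain-mono {suc N} R chain (suc k) (suc l) (s≤s k≤l) =
    chain-mono (λ j → R (suc j)) (λ j → chain (suc j)) k l k≤l

  unfold-preserves : ∀ {P N} (R : Frames N) →
                     Invariants P N R → last R ⊆ P → Invariants P (suc N) (snoc R U)
  unfold-preserves {P} R (init , post-step , ascending , safe) last⊆P =
      snoc-all (I ⊆_) R init (λ _ → tt)
    , snoc-chain (λ X Y → post X ⊆ Y) R post-step (λ _ → tt)
    , snoc-chain _⊆_ R ascending (λ _ → tt)
    , λ i → subst (_⊆ P) (sym (snoc-inject₁ R U i)) (init-last-all (_⊆ P) R safe last⊆P i)

  ⪯-trans : ∀ {x y z} → x ⪯ y → y ⪯ z → x ⪯ z
  ⪯-trans = IsPreorder.trans (IsWQO.isPreorder wqo)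

  -- Frame 0 is never updated, but it avoids ↑ b anyway because it is ↓ I.
  update-excludes : ∀ {N} (R : Frames N) m {b} → R zero ⊆ ↓ I → Empty (↑₁ b ∩ I) →
                    ∀ k {x} → update R m b k x → toℕ k ≤ m → ¬ b ⪯ x
  update-excludes R m R₀⊆↓I b∉↑I zero (x∈R₀ , _) _ b⪯x with R₀⊆↓I x∈R₀
  ... | y , y∈I , x⪯y = b∉↑I y (⪯-trans b⪯x x⪯y , y∈I)
  update-excludes R m _ _ (suc k) (_ , excluded) k≤m = excluded (s≤s z≤n) k≤m

  update-preserves : ∀ {P N} (R : Frames N) (j : Fin N) {b} →
                     R zero ⊆ ↓ I → Empty (↑₁ b ∩ I) →
                     Empty (pre (↑₁ b) ∩ (R (inject₁ j) ∖ ↑₁ b)) →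
                     Invariants P N R → Invariants P N (update R (suc (toℕ j)) b)
  update-preserves {P} {N} R j {b} R₀⊆↓I b∉↑I ↑b-closed (init , post-step , ascending , safe) =
    init′ , post-step′ , ascending′ , safe′
    where
    R′ : Frames N
    R′ = update R (suc (toℕ j)) b

    excludes : ∀ (i : Fin N) {x} → R′ (inject₁ i) x → suc (toℕ i) ≤ suc (toℕ j) → ¬ b ⪯ x
    excludes i x∈R′ i<m = update-excludes R _ R₀⊆↓I b∉↑I (inject₁ i) x∈R′
      (subst (_≤ suc (toℕ j)) (sym (toℕ-inject₁ i)) (m≤n⇒m≤1+n (s≤s⁻¹ i<m)))

    below-j : ∀ (i : Fin N) → suc (toℕ i) ≤ suc (toℕ j) → R (inject₁ i) ⊆ R (inject₁ j)
    below-j i i<m = chain-mono R ascending (inject₁ i) (inject₁ j)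
      (subst₂ _≤_ (sym (toℕ-inject₁ i)) (sym (toℕ-inject₁ j)) (s≤s⁻¹ i<m))

    init′ : ∀ i → I ⊆ R′ i
    init′ i {x} x∈I = init i x∈I , λ _ _ b⪯x → b∉↑I x (b⪯x , x∈I)

    -- A successor y ∈ ↑ b of some x ∈ R′ᵢ \ ↑ b would put x in pre(↑ b) ∩ (R_j \ ↑ b).
    post-step′ : Chain (λ X Y → post X ⊆ Y) R′
    post-step′ i {y} (x , x∈R′ , x⟶y) = post-step i (x , proj₁ x∈R′ , x⟶y) ,
      λ _ i<m b⪯y → ↑b-closed x ((y , b⪯y , x⟶y) ,
                                   below-j i i<m (proj₁ x∈R′) , excludes i x∈R′ i<m)

    ascending′ : Chain _⊆_ R′
    ascending′ i x∈R′ = ascending i (proj₁ x∈R′) , λ _ i<m → excludes i x∈R′ i<m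

    safe′ : ∀ (i : Fin N) → R′ (inject₁ i) ⊆ P
    safe′ i x∈R′ = safe i (proj₁ x∈R′)

lemma1 : (W : WSTS) → let open WSTSDefs W in
    (P : Set') → DownClosed P →
    (N : ℕ) (R : Frames N) (Q : Queue) →
    (∀ (k : Fin (suc N)) → DownClosed (R k)) →
    R zero ≐ (↓ I) →
    Invariants P N R →
    (N' : ℕ) (R' : Frames N') (Q' : Queue) →
    Step P N R Q N' R' Q' →
    Invariants P N' R'
lemma1 W P _ N R Q _ R₀≐↓I inv N' R' Q' = preserves
  where
  open WSTSDefs W
  open FrameVectors W

  preserves : Step P N R Q N' R' Q' → Invariants P N' R'
  preserves (candidateNondet _ _)                          = inv
  preserves (decideNondet _ _ _ _ _)                       = inv
  preserves (conflict _ _ j _ _ (_ , b∉↑I , ↑b-closed))    =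
    update-preserves R j (proj₁ R₀≐↓I) b∉↑I ↑b-closed inv
  preserves (induction i _ _ _ _ _ (_ , b∉↑I , ↑b-closed)) =
    update-preserves R i (proj₁ R₀≐↓I) b∉↑I ↑b-closed inv
  preserves (unfold last⊆P)                                = unfold-preserves R inv last⊆P
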